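{- Let $n \geq 1$ and let $E_n = \wedge\{\alpha_1,\dots,\alpha_n,\theta_1,\dots,\theta_n\}$ be the exterior algebra over $\mathbb{C}$ on $2n$ generators, bigraded by $(E_n)_{i,j} = \wedge^i\{\alpha_1,\dots,\alpha_n\}\otimes\wedge^j\{\theta_1,\dots,\theta_n\}$. Let $T: E_n \to E_n$ be the algebra homomorphism determined by $T(\theta_i) = \theta_i + \alpha_i$ and $T(\alpha_i) = \alpha_i$ for $1 \le i \le n$, and let $\tau: E_n \to E_n$ be the linear operator $\tau(f) = \sum_{i=1}^n \alpha_i \cdot (\partial/\partial\theta_i) f$. Then for $f \in E_n$ we have $T(f) = f$ if and only if $\tau(f) = 0$. In particular, the subalgebra $H^0(M,\mathcal{O}) := \{f \in E_n : T(f) = f\}$ is bigraded, i.e. $H^0(M,\mathcal{O}) = \bigoplus_{i,j} \big(H^0(M,\mathcal{O}) \cap (E_n)_{i,j}\big)$.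
   Context: For fermionic variables $\omega_1,\dots,\omega_m$, the operator $\partial/\partial\omega_i$ on $\wedge\{\omega_1,\dots,\omega_m\}$ is the linear extension of $\partial/\partial\omega_i(\omega_{j_1}\cdots\omega_{j_r}) = (-1)^{s-1}\omega_{j_1}\cdots\widehat{\omega_{j_s}}\cdots\omega_{j_r}$ if $j_s = i$, and $0$ if $i \notin\{j_1,\dots,j_r\}$, for distinct indices $j_1,\dots,j_r$ (hat denotes omission). Here it is applied on $E_n$ with respect to the variables $\theta_i$ (viewing $E_n$ as the exterior algebra on all $2n$ variables). The operator $\tau$ is bihomogeneous of bidegree $(1,-1)$. -}

module Defs where

open import Level using (Level; _⊔_)
open import Data.Bool using (Bool; true; false; if_then_else_)
open import Data.Nat using (ℕ; zero; suc) renaming (_+_ to _+ℕ_)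
open import Data.Fin using (Fin; zero; suc; _↑ˡ_; _↑ʳ_)
open import Data.Vec using (Vec; []; _∷_; lookup; _[_]≔_; take; drop)
open import Data.Fin.Subset using (Subset; ∣_∣)
open import Data.Product using (∃)
open import Relation.Nullary using (¬_; Dec; yes; no)
open import Relation.Binary.PropositionalEquality using (_≡_)
open import Data.Nat using (_≟_)
open import Algebra.Bundles using (CommutativeRing; Semiring)
import Algebra.Definitions.RawSemiring as RS

-- A field of characteristic zero (the paper works over ℂ).
record IsChar0Field {c ℓ} (R : CommutativeRing c ℓ) : Set (c ⊔ ℓ) where
  open CommutativeRing R
  field
    1≉0     : ¬ (1# ≈ 0#)
    inverse : ∀ x → ¬ (x ≈ 0#) → ∃ λ y → (x * y) ≈ 1#
    char0   : ∀ k → ¬ ((RS._×_ (Semiring.rawSemiring semiring) (suc k) 1#) ≈ 0#)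

module Exterior {c ℓ} (R : CommutativeRing c ℓ) where
  open CommutativeRing R using (_≈_; _+_; _*_; -_; 0#; 1#) renaming (Carrier to K)

  sgn : ℕ → K
  sgn zero    = 1#
  sgn (suc k) = - sgn k

  -- An element is its coefficient function on the standard basis of
  -- ordered monomials e_S (S a subset of the generators, product taken
  -- in increasing order).
  Ext : ℕ → Set c
  Ext m = Subset m → K

  infix 4 _≈E_
  _≈E_ : ∀ {m} → Ext m → Ext m → Set ℓ
  f ≈E g = ∀ S → f S ≈ g S

  0E : ∀ {m} → Ext m
  0E S = 0#

  _+E_ : ∀ {m} → Ext m → Ext m → Ext m
  (f +E g) S = f S + g S

  _·E_ : ∀ {m} → K → Ext m → Ext m
  (a ·E f) S = a * f S

  ∅ : ∀ {m} → Subset m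
  ∅ {zero}  = []
  ∅ {suc m} = false ∷ ∅

  isSingleton : ∀ {m} → Fin m → Subset m → Bool
  isSingleton zero    (x ∷ S) = if x then isEmpty S else false
    where
    isEmpty : ∀ {k} → Subset k → Bool
    isEmpty []           = true
    isEmpty (true  ∷ T)  = false
    isEmpty (false ∷ T)  = isEmpty T
  isSingleton (suc v) (x ∷ S) = if x then false else isSingleton v S

  isEmptyB : ∀ {m} → Subset m → Bool
  isEmptyB []          = true
  isEmptyB (true  ∷ T) = false
  isEmptyB (false ∷ T) = isEmptyB T

  1E : ∀ {m} → Ext m
  1E S = if isEmptyB S then 1# else 0#

  gen : ∀ {m} → Fin m → Ext m
  gen v S = if isSingleton v S then 1# else 0#

  Σsplit : ∀ {m} → Subset m → (Subset m → Subset m → K) → K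
  Σsplit {zero}  []        h = h [] []
  Σsplit {suc m} (false ∷ S) h = Σsplit S (λ A B → h (false ∷ A) (false ∷ B))
  Σsplit {suc m} (true  ∷ S) h =
    Σsplit S (λ A B → h (true ∷ A) (false ∷ B)) +
    Σsplit S (λ A B → h (false ∷ A) (true ∷ B))

  -- number of pairs (a , b) with a ∈ A, b ∈ B, a > b
  inv : ∀ {m} → Subset m → Subset m → ℕ
  inv []      []      = 0
  inv (x ∷ A) (y ∷ B) = (if y then ∣ A ∣ else 0) +ℕ inv A B

  -- product: e_A · e_B = (-1)^{inv A B} e_{A ∪ B} if A ∩ B = ∅, else 0
  _*E_ : ∀ {m} → Ext m → Ext m → Ext m
  (f *E g) S = Σsplit S (λ A B → sgn (inv A B) * (f A * g B))

  before : ∀ {m} → Fin m → Subset m → ℕ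
  before zero    S       = 0
  before (suc j) (x ∷ S) = (if x then 1 else 0) +ℕ before j S

  -- the fermionic derivative ∂/∂e_j :
  -- ∂ e_S = (-1)^{#{k ∈ S , k < j}} e_{S ∖ {j}} if j ∈ S, 0 otherwise
  ∂ : ∀ {m} → Fin m → Ext m → Ext m
  ∂ j f S = if lookup S j then 0# else (sgn (before j S) * f (S [ j ]≔ true))

  ΣE : ∀ {m} n → (Fin n → Ext m) → Ext m
  ΣE zero    h = 0E
  ΣE (suc n) h = h zero +E ΣE n (λ i → h (suc i))

  -- E_n : generators α_1..α_n (indices 0..n-1) then θ_1..θ_n (indices n..2n-1)
  E : ℕ → Set c
  E n = Ext (n +ℕ n)

  α : ∀ {n} → Fin n → E n
  α {n} i = gen (i ↑ˡ n)

  θ : ∀ {n} → Fin n → E n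
  θ {n} i = gen (n ↑ʳ i)

  τ : ∀ {n} → E n → E n
  τ {n} f = ΣE n (λ i → α i *E ∂ (n ↑ʳ i) f)

  record IsT (n : ℕ) (T : E n → E n) : Set (c ⊔ ℓ) where
    field
      cong    : ∀ {f g} → f ≈E g → T f ≈E T g
      hom-+   : ∀ f g → T (f +E g) ≈E (T f +E T g)
      hom-·   : ∀ a f → T (a ·E f) ≈E (a ·E T f)
      hom-*   : ∀ f g → T (f *E g) ≈E (T f *E T g)
      hom-1   : T 1E ≈E 1E
      on-α    : ∀ i → T (α {n} i) ≈E α i
      on-θ    : ∀ i → T (θ {n} i) ≈E (θ i +E α i)

  component : ∀ {n} → ℕ → ℕ → E n → E n
  component {n} i j f S with ∣ take n S ∣ ≟ i | ∣ drop n S ∣ ≟ j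
  ... | yes _ | yes _ = f S
  ... | _     | _     = 0#

module Submission where

-- Let Dᵢ = αᵢ ∂/∂θᵢ, so that τ = Σᵢ Dᵢ; the Dᵢ are linear, commute and square to zero.
-- Then T = ∏ᵢ (1 + Dᵢ): the product fixes 1 and, by the anticommutation relations between
-- left multiplication by a generator and the fermionic derivatives, sends x ∧ y to
-- T(x) ∧ ∏ᵢ (1 + Dᵢ) y for every generator x; as T is multiplicative, the two maps agree on
-- each monomial by induction on its degree. Expanding, ∏ᵢ (1 + Dᵢ) = Σₖ eₖ with eₖ the
-- elementary symmetric polynomials in the Dᵢ, and τ eₖ = (k + 1) eₖ₊₁. In characteristic 0,
-- τ f = 0 thus kills every eₖ f with k ≥ 1, so T f = f. Conversely, if Σ_{k ≥ 1} eₖ f = 0,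
-- applying τ repeatedly isolates the terms from the top and yields τ f = e₁ f = 0.
-- Finally τ has bidegree (1 , -1), so the bihomogeneous components of a τ-closed element
-- are τ-closed, hence fixed by T.

open import Defs
open import Level using (_⊔_)
open import Data.Nat using (ℕ; _≤_)
open import Data.Product using (_×_)
open import Algebra.Bundles using (CommutativeRing)
open import Function.Bundles using (_⇔_)

open import Data.Nat as ℕ using (zero; suc; z≤n; s≤s; _<_)
import Data.Nat.Properties as ℕ
open import Data.Bool using (true; false; if_then_else_)
open import Data.Fin as Fin using (Fin; zero; suc; _↑ˡ_; _↑ʳ_; splitAt)
import Data.Fin.Properties as Fin
open import Data.Vec using (Vec; []; _∷_; lookup; _[_]≔_; take; drop)
open import Data.Vec.Properties
  using (lookup∘update; lookup∘update′; []≔-commutes; []≔-idempotent; []≔-lookup; ∷-injectiveʳ; ≡-dec)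
import Data.Bool.Properties as Bool
open import Data.Fin.Subset using (Subset; ∣_∣)
open import Data.Product using (∃; _,_)
open import Data.Sum using (inj₁; inj₂)
open import Relation.Binary.Definitions using (tri<; tri≈; tri>)
open import Relation.Binary.Bundles using (Setoid)
open import Data.Empty using (⊥-elim)
open import Relation.Nullary using (¬_; Dec; yes; no)
open import Relation.Binary.PropositionalEquality as ≡
  using (_≡_; refl; _≢_)
open import Function.Base using (_∘_)
open import Function.Bundles using (mk⇔; Equivalence)
open import Algebra.Bundles using (Semiring)
import Algebra.Properties.Ring as RingProperties
import Algebra.Definitions.RawSemiring as RawSemiringDefinitions
import Relation.Binary.Reasoning.Setoid as SetoidReasoning

module _ {a} {A : Set a} where

  []≔-self : ∀ {m} (xs : Vec A m) i {x} → lookup xs i ≡ x → xs [ i ]≔ x ≡ xs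
  []≔-self xs i refl = []≔-lookup xs i

  take-[]≔-↑ˡ : ∀ p {k} (xs : Vec A (p ℕ.+ k)) (i : Fin p) x →
                take p (xs [ i ↑ˡ k ]≔ x) ≡ take p xs [ i ]≔ x
  take-[]≔-↑ˡ (suc p) (y ∷ xs) zero    x = refl
  take-[]≔-↑ˡ (suc p) (y ∷ xs) (suc i) x = ≡.cong (y ∷_) (take-[]≔-↑ˡ p xs i x)

  take-[]≔-↑ʳ : ∀ p {k} (xs : Vec A (p ℕ.+ k)) (i : Fin k) x →
                take p (xs [ p ↑ʳ i ]≔ x) ≡ take p xs
  take-[]≔-↑ʳ zero    xs       i x = refl
  take-[]≔-↑ʳ (suc p) (y ∷ xs) i x = ≡.cong (y ∷_) (take-[]≔-↑ʳ p xs i x)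

  drop-[]≔-↑ˡ : ∀ p {k} (xs : Vec A (p ℕ.+ k)) (i : Fin p) x →
                drop p (xs [ i ↑ˡ k ]≔ x) ≡ drop p xs
  drop-[]≔-↑ˡ (suc p) (y ∷ xs) zero    x = refl
  drop-[]≔-↑ˡ (suc p) (y ∷ xs) (suc i) x = drop-[]≔-↑ˡ p xs i x

  drop-[]≔-↑ʳ : ∀ p {k} (xs : Vec A (p ℕ.+ k)) (i : Fin k) x →
                drop p (xs [ p ↑ʳ i ]≔ x) ≡ drop p xs [ i ]≔ x
  drop-[]≔-↑ʳ zero    xs       i x = refl
  drop-[]≔-↑ʳ (suc p) (y ∷ xs) i x = drop-[]≔-↑ʳ p xs i x

  lookup-take : ∀ p {k} (xs : Vec A (p ℕ.+ k)) (i : Fin p) →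
                lookup (take p xs) i ≡ lookup xs (i ↑ˡ k)
  lookup-take (suc p) (y ∷ xs) zero    = refl
  lookup-take (suc p) (y ∷ xs) (suc i) = lookup-take p xs i

  lookup-drop : ∀ p {k} (xs : Vec A (p ℕ.+ k)) (i : Fin k) →
                lookup (drop p xs) i ≡ lookup xs (p ↑ʳ i)
  lookup-drop zero    xs       i = refl
  lookup-drop (suc p) (y ∷ xs) i = lookup-drop p xs i

↑ˡ≢↑ʳ : ∀ {m k} (i : Fin m) (j : Fin k) → i ↑ˡ k ≢ m ↑ʳ j
↑ˡ≢↑ʳ {m} {k} i j eq with ≡.trans (≡.sym (Fin.splitAt-↑ˡ m i k))
                                 (≡.trans (≡.cong (splitAt m) eq) (Fin.splitAt-↑ʳ m k j))
... | ()

∣p[i]≔outside∣ : ∀ {k} (p : Subset k) i → lookup p i ≡ true → suc ∣ p [ i ]≔ false ∣ ≡ ∣ p ∣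
∣p[i]≔outside∣ (true  ∷ p) zero    refl = refl
∣p[i]≔outside∣ (true  ∷ p) (suc i) e    = ≡.cong suc (∣p[i]≔outside∣ p i e)
∣p[i]≔outside∣ (false ∷ p) (suc i) e    = ∣p[i]≔outside∣ p i e

∣p[i]≔inside∣ : ∀ {k} (p : Subset k) i → lookup p i ≡ false → ∣ p [ i ]≔ true ∣ ≡ suc ∣ p ∣
∣p[i]≔inside∣ (false ∷ p) zero    refl = refl
∣p[i]≔inside∣ (true  ∷ p) (suc i) e    = ≡.cong suc (∣p[i]≔inside∣ p i e)
∣p[i]≔inside∣ (false ∷ p) (suc i) e    = ∣p[i]≔inside∣ p i e

∣p∣≡suc⇒∃inside : ∀ {k} (p : Subset k) j → ∣ p ∣ ≡ suc j →
                  ∃ λ i → lookup p i ≡ true × ∣ p [ i ]≔ false ∣ ≡ j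
∣p∣≡suc⇒∃inside (true  ∷ p) j e = zero , refl , ℕ.suc-injective e
∣p∣≡suc⇒∃inside (false ∷ p) j e with ∣p∣≡suc⇒∃inside p j e
... | i , inside , count = suc i , inside , count

module ExteriorAlgebra {c ℓ} (R : CommutativeRing c ℓ) where
  open CommutativeRing R
    hiding (zero) renaming (Carrier to K; refl to ≈-refl; sym to ≈-sym; trans to ≈-trans)
  open RingProperties ring
    using (-‿distribˡ-*; -‿distribʳ-*; -0#≈0#; -‿involutive; +-identityʳ-unique; -1*x≈-x)
  open Exterior R

  ≈E-setoid : ℕ → Setoid c ℓ
  ≈E-setoid m = record
    { Carrier       = Ext m
    ; _≈_           = _≈E_
    ; isEquivalence = record
      { refl  = λ _ → ≈-refl
      ; sym   = λ e S → ≈-sym (e S)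
      ; trans = λ e e′ S → ≈-trans (e S) (e′ S)
      }
    }

  module ≈E {m} = Setoid (≈E-setoid m)
  module ≈E-Reasoning {m} = SetoidReasoning (≈E-setoid m)
  open import Algebra.Properties.CommutativeSemigroup *-commutativeSemigroup
    using (x∙yz≈y∙xz)
  open import Algebra.Properties.CommutativeSemigroup +-commutativeSemigroup
    using () renaming (interchange to +-interchange)

  -x*y≈-[x*y] : ∀ x y → (- x) * y ≈ - (x * y)
  -x*y≈-[x*y] x y = ≈-sym (-‿distribˡ-* x y)

  x*-y≈-[x*y] : ∀ x y → x * (- y) ≈ - (x * y)
  x*-y≈-[x*y] x y = ≈-sym (-‿distribʳ-* x y)

  sgn*sgn≈1 : ∀ k → sgn k * sgn k ≈ 1#
  sgn*sgn≈1 zero    = *-identityˡ 1#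
  sgn*sgn≈1 (suc k) = begin
    (- sgn k) * (- sgn k)  ≈⟨ -x*y≈-[x*y] _ _ ⟩
    - (sgn k * - sgn k)    ≈⟨ -‿cong (x*-y≈-[x*y] _ _) ⟩
    - - (sgn k * sgn k)    ≈⟨ -‿involutive _ ⟩
    sgn k * sgn k          ≈⟨ sgn*sgn≈1 k ⟩
    1#                     ∎
    where open SetoidReasoning setoid

  sgn*[sgn*x]≈x : ∀ k x → sgn k * (sgn k * x) ≈ x
  sgn*[sgn*x]≈x k x =
    ≈-trans (≈-sym (*-assoc _ _ _)) (≈-trans (*-congʳ (sgn*sgn≈1 k)) (*-identityˡ x))

  infix 25 -E_
  -E_ : ∀ {m} → Ext m → Ext m
  (-E f) S = - f S

  +E-cong : ∀ {m} {f f′ g g′ : Ext m} → f ≈E f′ → g ≈E g′ → f +E g ≈E f′ +E g′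
  +E-cong e e′ S = +-cong (e S) (e′ S)

  ·E-cong : ∀ {m} a {f g : Ext m} → f ≈E g → a ·E f ≈E a ·E g
  ·E-cong a e S = *-congˡ (e S)

  -E-cong : ∀ {m} {f g : Ext m} → f ≈E g → -E f ≈E -E g
  -E-cong e S = -‿cong (e S)

  -E-involutive : ∀ {m} (f : Ext m) → -E -E f ≈E f
  -E-involutive f S = -‿involutive _

  -E0E≈0E : ∀ {m} → -E 0E {m} ≈E 0E
  -E0E≈0E S = -0#≈0#

  Op : ℕ → Set c
  Op m = Ext m → Ext m

  record IsLinear {m} (L : Op m) : Set (c ⊔ ℓ) where
    field
      cong   : ∀ {f g} → f ≈E g → L f ≈E L g
      +-homo : ∀ f g → L (f +E g) ≈E L f +E L g
      ·-homo : ∀ a f → L (a ·E f) ≈E a ·E L f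

    0-homo : L 0E ≈E 0E
    0-homo = ≈E.trans (cong (λ S → ≈-sym (zeroˡ 0#)))
                      (≈E.trans (·-homo 0# 0E) (λ S → zeroˡ _))

    neg-homo : ∀ f → L (-E f) ≈E -E L f
    neg-homo f = ≈E.trans (cong (λ S → ≈-sym (-1*x≈-x (f S))))
                          (≈E.trans (·-homo (- 1#) f) (λ S → -1*x≈-x _))

  IsLinear-resp : ∀ {m} {L L′ : Op m} → (∀ f → L f ≈E L′ f) → IsLinear L′ → IsLinear L
  IsLinear-resp L≈L′ lin = record
    { cong   = λ e → ≈E.trans (L≈L′ _) (≈E.trans (IsLinear.cong lin e) (≈E.sym (L≈L′ _)))
    ; +-homo = λ f g → ≈E.trans (L≈L′ _) (≈E.trans (IsLinear.+-homo lin f g) (≈E.sym (+E-cong (L≈L′ f) (L≈L′ g))))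
    ; ·-homo = λ a f → ≈E.trans (L≈L′ _) (≈E.trans (IsLinear.·-homo lin a f) (≈E.sym (·E-cong a (L≈L′ f))))
    }

  ∘-linear : ∀ {m} {L L′ : Op m} → IsLinear L → IsLinear L′ → IsLinear (L ∘ L′)
  ∘-linear lin lin′ = record
    { cong   = IsLinear.cong lin ∘ IsLinear.cong lin′
    ; +-homo = λ f g → ≈E.trans (IsLinear.cong lin (IsLinear.+-homo lin′ f g)) (IsLinear.+-homo lin _ _)
    ; ·-homo = λ a f → ≈E.trans (IsLinear.cong lin (IsLinear.·-homo lin′ a f)) (IsLinear.·-homo lin _ _)
    }

  -- Signs and the product with a generator

  before-remove : ∀ {m} (S : Subset m) u v → lookup S u ≡ true → u Fin.< v →
                  before v S ≡ suc (before v (S [ u ]≔ false))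
  before-remove (true ∷ S) zero    (suc v) refl u<v = refl
  before-remove (x ∷ S)    (suc u) (suc v) e    (s≤s u<v) =
    ≡.trans (≡.cong ((if x then 1 else 0) ℕ.+_) (before-remove S u v e u<v)) (ℕ.+-suc _ _)

  before-insert : ∀ {m} (S : Subset m) u v → lookup S u ≡ false → u Fin.< v →
                  before v (S [ u ]≔ true) ≡ suc (before v S)
  before-insert (false ∷ S) zero    (suc v) refl u<v = refl
  before-insert (x ∷ S)     (suc u) (suc v) e    (s≤s u<v) =
    ≡.trans (≡.cong ((if x then 1 else 0) ℕ.+_) (before-insert S u v e u<v)) (ℕ.+-suc _ _)

  before-update-≤ : ∀ {m} (S : Subset m) u v b → v Fin.≤ u → before v (S [ u ]≔ b) ≡ before v S
  before-update-≤ (x ∷ S) u       zero    b v≤u       = refl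
  before-update-≤ (x ∷ S) (suc u) (suc v) b (s≤s v≤u) =
    ≡.cong ((if x then 1 else 0) ℕ.+_) (before-update-≤ S u v b v≤u)

  single : ∀ {m} → Fin m → Subset m
  single v = ∅ [ v ]≔ true

  isEmptyB-∅ : ∀ {m} → isEmptyB (∅ {m}) ≡ true
  isEmptyB-∅ {zero}  = refl
  isEmptyB-∅ {suc m} = isEmptyB-∅ {m}

  isSingleton-zero : ∀ {m} (A : Subset m) → isSingleton zero (true ∷ A) ≡ isEmptyB A
  isSingleton-zero []          = refl
  isSingleton-zero (true  ∷ A) = refl
  isSingleton-zero (false ∷ A) = isSingleton-zero A

  isSingleton-single : ∀ {m} (v : Fin m) → isSingleton v (single v) ≡ true
  isSingleton-single {suc m} zero    = ≡.trans (isSingleton-zero (∅ {m})) (isEmptyB-∅ {m})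
  isSingleton-single         (suc v) = isSingleton-single v

  ∣∅∣≡0 : ∀ {m} → ∣ ∅ {m} ∣ ≡ 0
  ∣∅∣≡0 {zero}  = refl
  ∣∅∣≡0 {suc m} = ∣∅∣≡0 {m}

  ∣p∣≡0⇒p≡∅ : ∀ {m} (S : Subset m) → ∣ S ∣ ≡ 0 → S ≡ ∅
  ∣p∣≡0⇒p≡∅ []          e = refl
  ∣p∣≡0⇒p≡∅ (false ∷ S) e = ≡.cong (false ∷_) (∣p∣≡0⇒p≡∅ S e)

  ∣single∣≡1 : ∀ {m} (v : Fin m) → ∣ single v ∣ ≡ 1
  ∣single∣≡1 {suc m} zero    = ≡.cong suc (∣∅∣≡0 {m})
  ∣single∣≡1         (suc v) = ∣single∣≡1 v

  inv-∅ : ∀ {m} (B : Subset m) → inv ∅ B ≡ 0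
  inv-∅         []          = refl
  inv-∅ {suc m} (true  ∷ B) = ≡.cong₂ ℕ._+_ (∣∅∣≡0 {m}) (inv-∅ B)
  inv-∅         (false ∷ B) = inv-∅ B

  inv-single : ∀ {m} (v : Fin m) (B : Subset m) → inv (single v) B ≡ before v B
  inv-single {suc m} zero    (true  ∷ B) = ≡.cong₂ ℕ._+_ (∣∅∣≡0 {m}) (inv-∅ B)
  inv-single         zero    (false ∷ B) = inv-∅ B
  inv-single         (suc v) (true  ∷ B) = ≡.cong₂ ℕ._+_ (∣single∣≡1 v) (inv-single v B)
  inv-single         (suc v) (false ∷ B) = inv-single v B

  Split : ℕ → Set c
  Split m = Subset m → Subset m → K

  Σsplit-cong : ∀ {m} (S : Subset m) {h k : Split m} →
                (∀ A B → h A B ≈ k A B) → Σsplit S h ≈ Σsplit S k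
  Σsplit-cong []          e = e [] []
  Σsplit-cong (false ∷ S) e = Σsplit-cong S (λ A B → e _ _)
  Σsplit-cong (true  ∷ S) e = +-cong (Σsplit-cong S (λ A B → e _ _)) (Σsplit-cong S (λ A B → e _ _))

  Σsplit-+ : ∀ {m} (S : Subset m) (h k : Split m) →
             Σsplit S (λ A B → h A B + k A B) ≈ Σsplit S h + Σsplit S k
  Σsplit-+ []          h k = ≈-refl
  Σsplit-+ (false ∷ S) h k = Σsplit-+ S _ _
  Σsplit-+ (true  ∷ S) h k = ≈-trans (+-cong (Σsplit-+ S _ _) (Σsplit-+ S _ _)) (+-interchange _ _ _ _)

  Σsplit-0 : ∀ {m} (S : Subset m) {h : Split m} → (∀ A B → h A B ≈ 0#) → Σsplit S h ≈ 0#
  Σsplit-0 []          e = e [] []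
  Σsplit-0 (false ∷ S) e = Σsplit-0 S (λ A B → e _ _)
  Σsplit-0 (true  ∷ S) e =
    ≈-trans (+-cong (Σsplit-0 S (λ A B → e _ _)) (Σsplit-0 S (λ A B → e _ _))) (+-identityˡ 0#)

  Σsplit-∅ : ∀ {m} (S : Subset m) {h : Split m} →
             (∀ A B → isEmptyB A ≡ false → h A B ≈ 0#) → Σsplit S h ≈ h ∅ S
  Σsplit-∅ []          e = ≈-refl
  Σsplit-∅ (false ∷ S) e = Σsplit-∅ S (λ A B → e _ _)
  Σsplit-∅ (true  ∷ S) e =
    ≈-trans (+-cong (Σsplit-0 S (λ A B → e _ _ refl)) (Σsplit-∅ S (λ A B → e _ _))) (+-identityˡ _)

  Σsplit-single : ∀ {m} (S : Subset m) (v : Fin m) {h : Split m} →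
    (∀ A B → isSingleton v A ≡ false → h A B ≈ 0#) →
    Σsplit S h ≈ (if lookup S v then h (single v) (S [ v ]≔ false) else 0#)
  Σsplit-single (false ∷ S) zero    e = Σsplit-0 S (λ A B → e _ _ refl)
  Σsplit-single (true  ∷ S) zero    e =
    ≈-trans (+-cong (Σsplit-∅ S (λ A B z → e _ _ (≡.trans (isSingleton-zero A) z)))
                    (Σsplit-0 S (λ A B → e _ _ refl)))
            (+-identityʳ _)
  Σsplit-single (false ∷ S) (suc v) e = Σsplit-single S v (λ A B → e _ _)
  Σsplit-single (true  ∷ S) (suc v) e =
    ≈-trans (+-cong (Σsplit-0 S (λ A B → e _ _ refl)) (Σsplit-single S v (λ A B → e _ _)))
            (+-identityˡ _)

  *E-cong : ∀ {m} {f f′ g g′ : Ext m} → f ≈E f′ → g ≈E g′ → f *E g ≈E f′ *E g′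
  *E-cong e e′ S = Σsplit-cong S (λ A B → *-congˡ (*-cong (e A) (e′ B)))

  *E-distribʳ : ∀ {m} (f g h : Ext m) → (f +E g) *E h ≈E (f *E h) +E (g *E h)
  *E-distribʳ f g h S =
    ≈-trans (Σsplit-cong S (λ A B → ≈-trans (*-congˡ (distribʳ (h B) (f A) (g A))) (distribˡ _ _ _)))
            (Σsplit-+ S _ _)

  gen∧ : ∀ {m} → Fin m → Ext m → Ext m
  gen∧ v g S = if lookup S v then sgn (before v S) * g (S [ v ]≔ false) else 0#

  gen-*E≈gen∧ : ∀ {m} (v : Fin m) (g : Ext m) → gen v *E g ≈E gen∧ v g
  gen-*E≈gen∧ v g S = ≈-trans (Σsplit-single S v vanish) (on-single (lookup S v))
    where
    vanish : ∀ A B → isSingleton v A ≡ false → sgn (inv A B) * (gen v A * g B) ≈ 0#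
    vanish A B notSingle rewrite notSingle = ≈-trans (*-congˡ (zeroˡ _)) (zeroʳ _)
    on-single : ∀ b →
      (if b then sgn (inv (single v) (S [ v ]≔ false)) * (gen v (single v) * g (S [ v ]≔ false))
            else 0#)
      ≈ (if b then sgn (before v S) * g (S [ v ]≔ false) else 0#)
    on-single false = ≈-refl
    on-single true
      rewrite isSingleton-single v | inv-single v (S [ v ]≔ false)
            | before-update-≤ S v v false Fin.≤-refl
      = *-congˡ (*-identityˡ _)

  gen∧-linear : ∀ {m} (v : Fin m) → IsLinear (gen∧ v)
  gen∧-linear v = record { cong = cong′ ; +-homo = +-homo′ ; ·-homo = ·-homo′ }
    where
    cong′ : ∀ {f g} → f ≈E g → gen∧ v f ≈E gen∧ v g
    cong′ e S with lookup S v
    ... | true  = *-congˡ (e _)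
    ... | false = ≈-refl
    +-homo′ : ∀ f g → gen∧ v (f +E g) ≈E gen∧ v f +E gen∧ v g
    +-homo′ f g S with lookup S v
    ... | true  = distribˡ _ _ _
    ... | false = ≈-sym (+-identityˡ 0#)
    ·-homo′ : ∀ a f → gen∧ v (a ·E f) ≈E a ·E gen∧ v f
    ·-homo′ a f S with lookup S v
    ... | true  = x∙yz≈y∙xz _ _ _
    ... | false = ≈-sym (zeroʳ a)

  ∂-linear : ∀ {m} (t : Fin m) → IsLinear (∂ t)
  ∂-linear t = record { cong = cong′ ; +-homo = +-homo′ ; ·-homo = ·-homo′ }
    where
    cong′ : ∀ {f g} → f ≈E g → ∂ t f ≈E ∂ t g
    cong′ e S with lookup S t
    ... | false = *-congˡ (e _)
    ... | true  = ≈-refl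
    +-homo′ : ∀ f g → ∂ t (f +E g) ≈E ∂ t f +E ∂ t g
    +-homo′ f g S with lookup S t
    ... | false = distribˡ _ _ _
    ... | true  = ≈-sym (+-identityˡ 0#)
    ·-homo′ : ∀ a f → ∂ t (a ·E f) ≈E a ·E ∂ t f
    ·-homo′ a f S with lookup S t
    ... | false = x∙yz≈y∙xz _ _ _
    ... | true  = ≈-sym (zeroʳ a)

  isEmptyB-insert : ∀ {m} (S : Subset m) t → isEmptyB (S [ t ]≔ true) ≡ false
  isEmptyB-insert (x     ∷ S) zero    = refl
  isEmptyB-insert (true  ∷ S) (suc t) = refl
  isEmptyB-insert (false ∷ S) (suc t) = isEmptyB-insert S t

  ∂-1E : ∀ {m} (t : Fin m) → ∂ t 1E ≈E 0E
  ∂-1E t S with lookup S t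
  ... | true  = ≈-refl
  ... | false rewrite isEmptyB-insert S t = zeroʳ _

  gen∧-gen∧-same : ∀ {m} (v : Fin m) (z : Ext m) → gen∧ v (gen∧ v z) ≈E 0E
  gen∧-gen∧-same v z S with lookup S v
  ... | false = ≈-refl
  ... | true rewrite lookup∘update v S false = zeroʳ _

  private
    0≈-[a*b] : ∀ {a b} → b ≈ 0# → 0# ≈ - (a * b)
    0≈-[a*b] b≈0 = ≈-sym (≈-trans (-‿cong (≈-trans (*-congˡ b≈0) (zeroʳ _))) -0#≈0#)

    -[-a*[b*x]]≈b*[a*x] : ∀ a b x → - ((- a) * (b * x)) ≈ b * (a * x)
    -[-a*[b*x]]≈b*[a*x] a b x =
      ≈-trans (-‿cong (-x*y≈-[x*y] _ _)) (≈-trans (-‿involutive _) (x∙yz≈y∙xz _ _ _))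

    -a*[b*x]≈-[b*[a*x]] : ∀ a b x → (- a) * (b * x) ≈ - (b * (a * x))
    -a*[b*x]≈-[b*[a*x]] a b x = ≈-trans (-x*y≈-[x*y] _ _) (-‿cong (x∙yz≈y∙xz _ _ _))

    a*[-b*x]≈-[b*[a*x]] : ∀ a b x → a * ((- b) * x) ≈ - (b * (a * x))
    a*[-b*x]≈-[b*[a*x]] a b x =
      ≈-trans (*-congˡ (-x*y≈-[x*y] _ _)) (≈-trans (x*-y≈-[x*y] _ _) (-‿cong (x∙yz≈y∙xz _ _ _)))

  gen∧-anticomm : ∀ {m} (u v : Fin m) (z : Ext m) → u ≢ v →
                  gen∧ u (gen∧ v z) ≈E -E gen∧ v (gen∧ u z)
  gen∧-anticomm u v z u≢v S
    rewrite lookup∘update′ (u≢v ∘ ≡.sym) S false | lookup∘update′ u≢v S false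
          | []≔-commutes {x = false} {y = false} S u v u≢v
    with lookup S u in u∈S | lookup S v in v∈S
  ... | false | false = ≈-sym -0#≈0#
  ... | false | true  = 0≈-[a*b] ≈-refl
  ... | true  | false = ≈-trans (zeroʳ _) (≈-sym -0#≈0#)
  ... | true  | true  with Fin.<-cmp u v
  ...   | tri< u<v _ _ rewrite before-remove S u v u∈S u<v | before-update-≤ S v u false (ℕ.<⇒≤ u<v) =
    ≈-sym (-[-a*[b*x]]≈b*[a*x] _ _ _)
  ...   | tri≈ _ u≡v _ = ⊥-elim (u≢v u≡v)
  ...   | tri> _ _ v<u rewrite before-remove S v u v∈S v<u | before-update-≤ S u v false (ℕ.<⇒≤ v<u) =
    -a*[b*x]≈-[b*[a*x]] _ _ _

  ∂-anticomm : ∀ {m} (u v : Fin m) (y : Ext m) → u ≢ v → ∂ u (∂ v y) ≈E -E ∂ v (∂ u y)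
  ∂-anticomm u v y u≢v S
    rewrite lookup∘update′ (u≢v ∘ ≡.sym) S true | lookup∘update′ u≢v S true
          | []≔-commutes {x = true} {y = true} S u v u≢v
    with lookup S u in u∈S | lookup S v in v∈S
  ... | true  | true  = ≈-sym -0#≈0#
  ... | true  | false = 0≈-[a*b] ≈-refl
  ... | false | true  = ≈-trans (zeroʳ _) (≈-sym -0#≈0#)
  ... | false | false with Fin.<-cmp u v
  ...   | tri< u<v _ _ rewrite before-insert S u v u∈S u<v | before-update-≤ S v u true (ℕ.<⇒≤ u<v) =
    a*[-b*x]≈-[b*[a*x]] _ _ _
  ...   | tri≈ _ u≡v _ = ⊥-elim (u≢v u≡v)
  ...   | tri> _ _ v<u rewrite before-insert S v u v∈S v<u | before-update-≤ S u v true (ℕ.<⇒≤ v<u) =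
    ≈-sym (≈-trans (-‿cong (a*[-b*x]≈-[b*[a*x]] _ _ _)) (-‿involutive _))

  ∂-gen∧-anticomm : ∀ {m} (t v : Fin m) (y : Ext m) → v ≢ t → ∂ t (gen∧ v y) ≈E -E gen∧ v (∂ t y)
  ∂-gen∧-anticomm t v y v≢t S
    rewrite lookup∘update′ (v≢t ∘ ≡.sym) S false | lookup∘update′ v≢t S true
          | []≔-commutes {x = true} {y = false} S t v (v≢t ∘ ≡.sym)
    with lookup S t in t∈S | lookup S v in v∈S
  ... | true  | false = ≈-sym -0#≈0#
  ... | true  | true  = 0≈-[a*b] ≈-refl
  ... | false | false = ≈-trans (zeroʳ _) (≈-sym -0#≈0#)
  ... | false | true with Fin.<-cmp t v
  ...   | tri< t<v _ _ rewrite before-insert S t v t∈S t<v | before-update-≤ S v t false (ℕ.<⇒≤ t<v) =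
    a*[-b*x]≈-[b*[a*x]] _ _ _
  ...   | tri≈ _ t≡v _ = ⊥-elim (v≢t (≡.sym t≡v))
  ...   | tri> _ _ v<t rewrite before-remove S v t v∈S v<t | before-update-≤ S t v true (ℕ.<⇒≤ v<t) =
    -a*[b*x]≈-[b*[a*x]] _ _ _

  ∂-gen∧-same : ∀ {m} (t : Fin m) (y : Ext m) → ∂ t (gen∧ t y) +E gen∧ t (∂ t y) ≈E y
  ∂-gen∧-same t y S
    rewrite lookup∘update t S true | lookup∘update t S false
          | []≔-idempotent {x = true} {y = false} S t | []≔-idempotent {x = false} {y = true} S t
          | before-update-≤ S t t true Fin.≤-refl | before-update-≤ S t t false Fin.≤-refl
    with lookup S t in t∈S
  ... | false rewrite []≔-self S t t∈S = ≈-trans (+-identityʳ _) (sgn*[sgn*x]≈x (before t S) _)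
  ... | true  rewrite []≔-self S t t∈S = ≈-trans (+-identityˡ _) (sgn*[sgn*x]≈x (before t S) _)


  ∂-gen∧≈id-gen∧∂ : ∀ {m} (t : Fin m) (y : Ext m) → ∂ t (gen∧ t y) ≈E y +E -E gen∧ t (∂ t y)
  ∂-gen∧≈id-gen∧∂ t y S = begin
    ∂ t (gen∧ t y) S                             ≈⟨ +-identityʳ _ ⟨
    ∂ t (gen∧ t y) S + 0#                        ≈⟨ +-congˡ (-‿inverseʳ _) ⟨
    ∂ t (gen∧ t y) S + (e∂ S + - e∂ S)           ≈⟨ +-assoc _ _ _ ⟨
    (∂ t (gen∧ t y) S + e∂ S) + - e∂ S           ≈⟨ +-congʳ (∂-gen∧-same t y S) ⟩
    y S + - e∂ S                                 ∎
    where
    open SetoidReasoning setoid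
    e∂ : Ext _
    e∂ = gen∧ t (∂ t y)
  -- The monomial basis

  _≟S_ : ∀ {m} (S U : Subset m) → Dec (S ≡ U)
  _≟S_ = ≡-dec Bool._≟_

  δ : ∀ {m} → Subset m → Ext m
  δ S U with S ≟S U
  ... | yes _ = 1#
  ... | no  _ = 0#

  δ-on : ∀ {m} (S : Subset m) → δ S S ≈ 1#
  δ-on S with S ≟S S
  ... | yes _   = ≈-refl
  ... | no  S≢S = ⊥-elim (S≢S refl)

  δ-off : ∀ {m} (S U : Subset m) → S ≢ U → δ S U ≈ 0#
  δ-off S U S≢U with S ≟S U
  ... | yes S≡U = ⊥-elim (S≢U S≡U)
  ... | no  _   = ≈-refl

  isEmptyB⇒≡∅ : ∀ {m} (U : Subset m) → isEmptyB U ≡ true → U ≡ ∅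
  isEmptyB⇒≡∅ []          e = refl
  isEmptyB⇒≡∅ (false ∷ U) e = ≡.cong (false ∷_) (isEmptyB⇒≡∅ U e)

  δ∅≈1E : ∀ {m} → δ (∅ {m}) ≈E 1E
  δ∅≈1E {m} U with ∅ ≟S U
  ... | yes refl rewrite isEmptyB-∅ {m} = ≈-refl
  ... | no  ∅≢U with isEmptyB U in empty
  ...   | true  = ⊥-elim (∅≢U (≡.sym (isEmptyB⇒≡∅ U empty)))
  ...   | false = ≈-refl

  private
    true≢false : true ≢ false
    true≢false ()

  δ≈gen∧ : ∀ {m} (S : Subset m) v → lookup S v ≡ true →
           δ S ≈E sgn (before v S) ·E gen∧ v (δ (S [ v ]≔ false))
  δ≈gen∧ S v v∈S W with lookup W v in v∈W
  ... | false = ≈-trans (δ-off S W (λ { refl → true≢false (≡.trans (≡.sym v∈S) v∈W) }))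
                        (≈-sym (zeroʳ _))
  ... | true with S ≟S W
  ...   | yes refl = ≈-sym (≈-trans (*-congˡ (*-congˡ (δ-on (S [ v ]≔ false))))
                              (≈-trans (*-congˡ (*-identityʳ _)) (sgn*sgn≈1 (before v S))))
  ...   | no  S≢W =
    ≈-sym (≈-trans (*-congˡ (*-congˡ (δ-off _ _ removed≢))) (≈-trans (*-congˡ (zeroʳ _)) (zeroʳ _)))
    where
    removed≢ : S [ v ]≔ false ≢ W [ v ]≔ false
    removed≢ eq = S≢W (begin
      S                          ≡⟨ ≡.sym ([]≔-self S v v∈S) ⟩
      S [ v ]≔ true              ≡⟨ ≡.sym ([]≔-idempotent S v) ⟩
      (S [ v ]≔ false) [ v ]≔ true ≡⟨ ≡.cong (_[ v ]≔ true) eq ⟩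
      (W [ v ]≔ false) [ v ]≔ true ≡⟨ []≔-idempotent W v ⟩
      W [ v ]≔ true              ≡⟨ []≔-self W v v∈W ⟩
      W                          ∎)
      where open ≡.≡-Reasoning

  ΣSub : ∀ {m k} → (Subset k → Ext m) → Ext m
  ΣSub {k = zero}  h = h []
  ΣSub {k = suc k} h = ΣSub (λ S → h (false ∷ S)) +E ΣSub (λ S → h (true ∷ S))

  ΣSub-0 : ∀ {m k} (h : Subset k → Ext m) U → (∀ S → h S U ≈ 0#) → ΣSub h U ≈ 0#
  ΣSub-0 {k = zero}  h U e = e []
  ΣSub-0 {k = suc k} h U e =
    ≈-trans (+-cong (ΣSub-0 (λ S → h (false ∷ S)) U (λ S → e _)) (ΣSub-0 (λ S → h (true ∷ S)) U (λ S → e _)))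
            (+-identityˡ 0#)

  ΣSub-single : ∀ {m k} (h : Subset k → Ext m) U S₀ → (∀ S → S ≢ S₀ → h S U ≈ 0#) → ΣSub h U ≈ h S₀ U
  ΣSub-single {k = zero}  h U [] e = ≈-refl
  ΣSub-single {k = suc k} h U (false ∷ S₀) e =
    ≈-trans (+-cong (ΣSub-single (λ S → h (false ∷ S)) U S₀ (λ S S≢S₀ → e _ (S≢S₀ ∘ ∷-injectiveʳ)))
                    (ΣSub-0 (λ S → h (true ∷ S)) U (λ S → e _ λ ())))
            (+-identityʳ _)
  ΣSub-single {k = suc k} h U (true ∷ S₀) e =
    ≈-trans (+-cong (ΣSub-0 (λ S → h (false ∷ S)) U (λ S → e _ λ ()))
                    (ΣSub-single (λ S → h (true ∷ S)) U S₀ (λ S S≢S₀ → e _ (S≢S₀ ∘ ∷-injectiveʳ))))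
            (+-identityˡ _)

  ΣSub-cong : ∀ {m k} {h h′ : Subset k → Ext m} → (∀ S → h S ≈E h′ S) → ΣSub h ≈E ΣSub h′
  ΣSub-cong {k = zero}  e = e []
  ΣSub-cong {k = suc k} e =
    +E-cong (ΣSub-cong {k = k} (λ S → e (false ∷ S))) (ΣSub-cong {k = k} (λ S → e (true ∷ S)))

  ΣSub-homo : ∀ {m k} {L : Ext m → Ext m} → IsLinear L →
              (h : Subset k → Ext m) → L (ΣSub h) ≈E ΣSub (λ S → L (h S))
  ΣSub-homo {k = zero}  lin h = ≈E.refl
  ΣSub-homo {k = suc k} lin h =
    ≈E.trans (IsLinear.+-homo lin _ _)
             (+E-cong (ΣSub-homo {k = k} lin (λ S → h (false ∷ S))) (ΣSub-homo {k = k} lin (λ S → h (true ∷ S))))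

  expand-in-basis : ∀ {m} (f : Ext m) → f ≈E ΣSub (λ S → f S ·E δ S)
  expand-in-basis f U = ≈-sym (≈-trans
    (ΣSub-single (λ S → f S ·E δ S) U U (λ S S≢U → ≈-trans (*-congˡ (δ-off S U S≢U)) (zeroʳ _)))
    (≈-trans (*-congˡ (δ-on U)) (*-identityʳ _)))

  linear-≈-on-basis : ∀ {m} {L L′ : Ext m → Ext m} → IsLinear L → IsLinear L′ →
                      (∀ S → L (δ S) ≈E L′ (δ S)) → ∀ f → L f ≈E L′ f
  linear-≈-on-basis {L = L} {L′} lin lin′ onBasis f = begin
    L f                               ≈⟨ IsLinear.cong lin (expand-in-basis f) ⟩
    L (ΣSub (λ S → f S ·E δ S))       ≈⟨ ΣSub-homo lin (λ S → f S ·E δ S) ⟩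
    ΣSub (λ S → L (f S ·E δ S))       ≈⟨ ΣSub-cong onTerm ⟩
    ΣSub (λ S → L′ (f S ·E δ S))      ≈⟨ ΣSub-homo lin′ (λ S → f S ·E δ S) ⟨
    L′ (ΣSub (λ S → f S ·E δ S))      ≈⟨ IsLinear.cong lin′ (expand-in-basis f) ⟨
    L′ f                              ∎
    where
    open ≈E-Reasoning
    onTerm : ∀ S → L (f S ·E δ S) ≈E L′ (f S ·E δ S)
    onTerm S = ≈E.trans (IsLinear.·-homo lin _ _)
                 (≈E.trans (·E-cong (f S) (onBasis S)) (≈E.sym (IsLinear.·-homo lin′ _ _)))

  unital-hom-unique : ∀ {m} {T Φ : Ext m → Ext m} → IsLinear T → IsLinear Φ →
    (∀ f g → T (f *E g) ≈E T f *E T g) → T 1E ≈E 1E → Φ 1E ≈E 1E →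
    (∀ v y → Φ (gen∧ v y) ≈E T (gen v) *E Φ y) → ∀ f → T f ≈E Φ f
  unital-hom-unique {T = T} {Φ} linT linΦ T-* T-1 Φ-1 Φ-gen∧ =
    linear-≈-on-basis linT linΦ (λ S → on-basis _ S refl)
    where
    open ≈E-Reasoning
    on-basis : ∀ k S → ∣ S ∣ ≡ k → T (δ S) ≈E Φ (δ S)
    on-basis zero S ∣S∣≡0 rewrite ∣p∣≡0⇒p≡∅ S ∣S∣≡0 = begin
      T (δ ∅) ≈⟨ IsLinear.cong linT δ∅≈1E ⟩
      T 1E    ≈⟨ T-1 ⟩
      1E      ≈⟨ Φ-1 ⟨
      Φ 1E    ≈⟨ IsLinear.cong linΦ δ∅≈1E ⟨
      Φ (δ ∅) ∎
    on-basis (suc k) S ∣S∣≡1+k with ∣p∣≡suc⇒∃inside S k ∣S∣≡1+k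
    ... | v , v∈S , ∣U∣≡k = begin
      T (δ S)                       ≈⟨ IsLinear.cong linT δS≈ ⟩
      T (s ·E (gen v *E δ U))       ≈⟨ IsLinear.·-homo linT _ _ ⟩
      s ·E T (gen v *E δ U)         ≈⟨ ·E-cong s (T-* _ _) ⟩
      s ·E (T (gen v) *E T (δ U))   ≈⟨ ·E-cong s (*E-cong ≈E.refl (on-basis k U ∣U∣≡k)) ⟩
      s ·E (T (gen v) *E Φ (δ U))   ≈⟨ ·E-cong s (Φ-gen∧ v (δ U)) ⟨
      s ·E Φ (gen∧ v (δ U))         ≈⟨ IsLinear.·-homo linΦ _ _ ⟨
      Φ (s ·E gen∧ v (δ U))         ≈⟨ IsLinear.cong linΦ (δ≈gen∧ S v v∈S) ⟨
      Φ (δ S)                       ∎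
      where
      U : Subset _
      U = S [ v ]≔ false
      s : K
      s = sgn (before v S)
      δS≈ : δ S ≈E s ·E (gen v *E δ U)
      δS≈ = ≈E.trans (δ≈gen∧ S v v∈S) (·E-cong s (≈E.sym (gen-*E≈gen∧ v (δ U))))

  -- Commuting square-zero operators

  ΣE-cong : ∀ {m} N {h k : Fin N → Ext m} → (∀ i → h i ≈E k i) → ΣE N h ≈E ΣE N k
  ΣE-cong zero    e = ≈E.refl
  ΣE-cong (suc N) e = +E-cong (e zero) (ΣE-cong N (e ∘ suc))


  ΣE-cong-at : ∀ {m} N S {h k : Fin N → Ext m} → (∀ i → h i S ≈ k i S) → ΣE N h S ≈ ΣE N k S
  ΣE-cong-at zero    S e = ≈-refl
  ΣE-cong-at (suc N) S e = +-cong (e zero) (ΣE-cong-at N S (e ∘ suc))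
  ΣE-0 : ∀ {m} N {h : Fin N → Ext m} → (∀ i → h i ≈E 0E) → ΣE N h ≈E 0E
  ΣE-0 zero    e = ≈E.refl
  ΣE-0 (suc N) e S = ≈-trans (+-cong (e zero S) (ΣE-0 N (e ∘ suc) S)) (+-identityˡ 0#)

  ΣE-+ : ∀ {m} N (h k : Fin N → Ext m) → ΣE N (λ i → h i +E k i) ≈E ΣE N h +E ΣE N k
  ΣE-+ zero    h k S = ≈-sym (+-identityˡ 0#)
  ΣE-+ (suc N) h k S = ≈-trans (+-congˡ (ΣE-+ N _ _ S)) (+-interchange _ _ _ _)

  ΣE-· : ∀ {m} N a (h : Fin N → Ext m) → ΣE N (λ i → a ·E h i) ≈E a ·E ΣE N h
  ΣE-· zero    a h S = ≈-sym (zeroʳ a)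
  ΣE-· (suc N) a h S = ≈-trans (+-congˡ (ΣE-· N a _ S)) (≈-sym (distribˡ _ _ _))

  ΣE-homo : ∀ {m} {L : Op m} → IsLinear L → ∀ N (h : Fin N → Ext m) →
            L (ΣE N h) ≈E ΣE N (λ i → L (h i))
  ΣE-homo lin zero    h = IsLinear.0-homo lin
  ΣE-homo lin (suc N) h = ≈E.trans (IsLinear.+-homo lin _ _) (+E-cong ≈E.refl (ΣE-homo lin N _))

  ΣD : ∀ {m} N → (Fin N → Op m) → Op m
  ΣD N D f = ΣE N (λ i → D i f)

  ΣD-linear : ∀ {m} N (D : Fin N → Op m) → (∀ i → IsLinear (D i)) → IsLinear (ΣD N D)
  ΣD-linear N D lin = record
    { cong   = λ e → ΣE-cong N (λ i → IsLinear.cong (lin i) e)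
    ; +-homo = λ f g → ≈E.trans (ΣE-cong N (λ i → IsLinear.+-homo (lin i) f g)) (ΣE-+ N _ _)
    ; ·-homo = λ a f → ≈E.trans (ΣE-cong N (λ i → IsLinear.·-homo (lin i) a f)) (ΣE-· N a _)
    }

  id+ : ∀ {m} → Op m → Op m
  id+ L y = y +E L y

  id+-linear : ∀ {m} {L : Op m} → IsLinear L → IsLinear (id+ L)
  id+-linear lin = record
    { cong   = λ e → +E-cong e (IsLinear.cong lin e)
    ; +-homo = λ f g S → ≈-trans (+-congˡ (IsLinear.+-homo lin f g S)) (+-interchange _ _ _ _)
    ; ·-homo = λ a f S → ≈-trans (+-congˡ (IsLinear.·-homo lin a f S)) (≈-sym (distribˡ _ _ _))
    }

  ∏id+ : ∀ {m} N → (Fin N → Op m) → Op m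
  ∏id+ zero    D f = f
  ∏id+ (suc N) D f = id+ (D zero) (∏id+ N (D ∘ suc) f)

  ∏id+-linear : ∀ {m} N (D : Fin N → Op m) → (∀ i → IsLinear (D i)) → IsLinear (∏id+ N D)
  ∏id+-linear zero    D lin = record { cong = λ e → e ; +-homo = λ _ _ → ≈E.refl ; ·-homo = λ _ _ → ≈E.refl }
  ∏id+-linear (suc N) D lin = record
    { cong   = λ e → IsLinear.cong head (IsLinear.cong rest e)
    ; +-homo = λ f g → ≈E.trans (IsLinear.cong head (IsLinear.+-homo rest f g)) (IsLinear.+-homo head _ _)
    ; ·-homo = λ a f → ≈E.trans (IsLinear.cong head (IsLinear.·-homo rest a f)) (IsLinear.·-homo head _ _)
    }
    where
    rest : IsLinear (∏id+ N (D ∘ suc))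
    rest = ∏id+-linear N (D ∘ suc) (lin ∘ suc)
    head : IsLinear (id+ (D zero))
    head = id+-linear (lin zero)

  ∏id+-fixes-common-kernel : ∀ {m} N (D : Fin N → Op m) → (∀ i → IsLinear (D i)) →
                             ∀ g → (∀ i → D i g ≈E 0E) → ∏id+ N D g ≈E g
  ∏id+-fixes-common-kernel zero    D lin g ker = ≈E.refl
  ∏id+-fixes-common-kernel (suc N) D lin g ker S =
    ≈-trans (+-cong (rest S) (≈-trans (IsLinear.cong (lin zero) rest S) (ker zero S))) (+-identityʳ _)
    where
    rest : ∏id+ N (D ∘ suc) g ≈E g
    rest = ∏id+-fixes-common-kernel N (D ∘ suc) (lin ∘ suc) g (ker ∘ suc)

  ∏id+-intertwines : ∀ {m} N (D : Fin N → Op m) → (∀ i → IsLinear (D i)) → (A : Op m) →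
    (∀ i y → id+ (D i) (A y) ≈E A (id+ (D i) y)) → ∀ y → ∏id+ N D (A y) ≈E A (∏id+ N D y)
  ∏id+-intertwines zero    D lin A comm y = ≈E.refl
  ∏id+-intertwines (suc N) D lin A comm y =
    ≈E.trans (IsLinear.cong (id+-linear (lin zero)) (∏id+-intertwines N (D ∘ suc) (lin ∘ suc) A (comm ∘ suc) y))
             (comm zero _)

  ∏id+-intertwines-except : ∀ {m} N (D : Fin N → Op m) → (∀ i → IsLinear (D i)) → (j : Fin N) →
    (A B : Op m) →
    (∀ i → i ≢ j → ∀ y → id+ (D i) (A y) ≈E A (id+ (D i) y)) →
    (∀ i → i ≢ j → ∀ y → id+ (D i) (B y) ≈E B (id+ (D i) y)) →
    (∀ y → id+ (D j) (A y) ≈E B (id+ (D j) y)) →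
    ∀ y → ∏id+ N D (A y) ≈E B (∏id+ N D y)
  ∏id+-intertwines-except (suc N) D lin zero A B commA commB commⱼ y =
    ≈E.trans (IsLinear.cong (id+-linear (lin zero))
               (∏id+-intertwines N (D ∘ suc) (lin ∘ suc) A (λ i → commA (suc i) λ ()) y))
             (commⱼ _)
  ∏id+-intertwines-except (suc N) D lin (suc j) A B commA commB commⱼ y =
    ≈E.trans (IsLinear.cong (id+-linear (lin zero))
               (∏id+-intertwines-except N (D ∘ suc) (lin ∘ suc) j A B
                 (λ i i≢j → commA (suc i) (i≢j ∘ Fin.suc-injective))
                 (λ i i≢j → commB (suc i) (i≢j ∘ Fin.suc-injective)) commⱼ y))
             (commB zero (λ ()) _)

  record IsCommutingSquareZero {m N} (D : Fin N → Op m) : Set (c ⊔ ℓ) where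
    field
      linear      : ∀ i → IsLinear (D i)
      commute     : ∀ i j f → D i (D j f) ≈E D j (D i f)
      square-zero : ∀ i f → D i (D i f) ≈E 0E

  IsCommutingSquareZero-tail : ∀ {m N} {D : Fin (suc N) → Op m} →
                               IsCommutingSquareZero D → IsCommutingSquareZero (D ∘ suc)
  IsCommutingSquareZero-tail isCSZ = record
    { linear      = linear ∘ suc
    ; commute     = λ i j → commute (suc i) (suc j)
    ; square-zero = square-zero ∘ suc
    }
    where open IsCommutingSquareZero isCSZ

  -- esym N D k is the k-th elementary symmetric polynomial in D 0, …, D (N - 1).
  esym : ∀ {m} N → (Fin N → Op m) → ℕ → Op m
  esym N       D zero    f = f
  esym zero    D (suc k) f = 0E
  esym (suc N) D (suc k) f = esym N (D ∘ suc) (suc k) f +E D zero (esym N (D ∘ suc) k f)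

  esym-vanishes : ∀ {m} N (D : Fin N → Op m) → (∀ i → IsLinear (D i)) →
                  ∀ k f → N < k → esym N D k f ≈E 0E
  esym-vanishes zero    D lin (suc k) f N<k       = ≈E.refl
  esym-vanishes (suc N) D lin (suc k) f (s≤s N<k) S =
    ≈-trans (+-cong (esym-vanishes N (D ∘ suc) (lin ∘ suc) (suc k) f (ℕ.m≤n⇒m≤1+n N<k) S)
                    (≈-trans (IsLinear.cong (lin zero) (esym-vanishes N (D ∘ suc) (lin ∘ suc) k f N<k) S)
                             (IsLinear.0-homo (lin zero) S)))
            (+-identityˡ 0#)

  ∏id+≈Σesym : ∀ {m} N (D : Fin N → Op m) → (∀ i → IsLinear (D i)) →
               ∀ f M → N < M → ∏id+ N D f ≈E ΣE M (λ k → esym N D (Fin.toℕ k) f)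
  ∏id+≈Σesym zero    D lin f (suc M) _ S =
    ≈-sym (≈-trans (+-congˡ (ΣE-0 M (λ _ → ≈E.refl) S)) (+-identityʳ _))
  ∏id+≈Σesym (suc N) D lin f (suc M) (s≤s N<M) = begin
    ∏id+ N D′ f +E D zero (∏id+ N D′ f)
      ≈⟨ +E-cong (∏id+≈Σesym N D′ (lin ∘ suc) f (suc M) (ℕ.m≤n⇒m≤1+n N<M))
                 (≈E.trans (IsLinear.cong (lin zero) (∏id+≈Σesym N D′ (lin ∘ suc) f M N<M))
                           (ΣE-homo (lin zero) M _)) ⟩
    (f +E ΣE M (λ k → e′ (suc (Fin.toℕ k)))) +E ΣE M (λ k → D zero (e′ (Fin.toℕ k)))
      ≈⟨ (λ S → +-assoc _ _ _) ⟩
    f +E (ΣE M (λ k → e′ (suc (Fin.toℕ k))) +E ΣE M (λ k → D zero (e′ (Fin.toℕ k))))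
      ≈⟨ +E-cong ≈E.refl (≈E.sym (ΣE-+ M _ _)) ⟩
    ΣE (suc M) (λ k → esym (suc N) D (Fin.toℕ k) f)
      ∎
    where
    open ≈E-Reasoning
    D′ : Fin N → Op _
    D′ = D ∘ suc
    e′ : ℕ → Ext _
    e′ = λ k → esym N D′ k f

  ι : ℕ → K
  ι k = RawSemiringDefinitions._×_ (Semiring.rawSemiring semiring) k 1#

  private
    a+ι1*b≈ι1*[b+a] : ∀ a b → a + ι 1 * b ≈ ι 1 * (b + a)
    a+ι1*b≈ι1*[b+a] a b = begin
      a + ι 1 * b     ≈⟨ +-congˡ (≈-trans (*-congʳ (+-identityʳ 1#)) (*-identityˡ b)) ⟩
      a + b           ≈⟨ +-comm a b ⟩
      b + a           ≈⟨ *-identityˡ _ ⟨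
      1# * (b + a)    ≈⟨ *-congʳ (+-identityʳ 1#) ⟨
      ι 1 * (b + a)   ∎
      where open SetoidReasoning setoid

    a+[[1+c]*b+c*a]≈[1+c]*[b+a] : ∀ a b c → a + ((1# + c) * b + c * a) ≈ (1# + c) * (b + a)
    a+[[1+c]*b+c*a]≈[1+c]*[b+a] a b c = begin
      a + ((1# + c) * b + c * a)         ≈⟨ +-congˡ (+-comm _ _) ⟩
      a + (c * a + (1# + c) * b)         ≈⟨ +-assoc _ _ _ ⟨
      (a + c * a) + (1# + c) * b         ≈⟨ +-congʳ (+-congʳ (*-identityˡ a)) ⟨
      (1# * a + c * a) + (1# + c) * b    ≈⟨ +-congʳ (distribʳ a 1# c) ⟨
      (1# + c) * a + (1# + c) * b        ≈⟨ +-comm _ _ ⟩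
      (1# + c) * b + (1# + c) * a        ≈⟨ distribˡ _ b a ⟨
      (1# + c) * (b + a)                 ∎
      where open SetoidReasoning setoid

  -- Each monomial of e_(k+1) arises from k + 1 monomials of e_k, one for each of its factors.
  ΣD-esym : ∀ {m} N {D : Fin N → Op m} → IsCommutingSquareZero D →
            ∀ k f → ΣD N D (esym N D k f) ≈E ι (suc k) ·E esym N D (suc k) f
  ΣD-esym zero    isCSZ k f S = ≈-sym (zeroʳ _)
  ΣD-esym (suc N) isCSZ zero f S =
    ≈-trans (+-congˡ (ΣD-esym N (IsCommutingSquareZero-tail isCSZ) zero f S)) (a+ι1*b≈ι1*[b+a] _ _)
  ΣD-esym (suc N) {D} isCSZ (suc k) f S = begin
    D₀ X S + ΣD N D′ X S
      ≈⟨ +-cong (IsLinear.+-homo (linear zero) _ _ S) (IsLinear.+-homo (ΣD-linear N D′ (linear ∘ suc)) _ _ S) ⟩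
    (D₀ (e′ (suc k)) S + D₀ (D₀ (e′ k)) S) + (ΣD N D′ (e′ (suc k)) S + ΣD N D′ (D₀ (e′ k)) S)
      ≈⟨ +-cong (+-congˡ (square-zero zero _ S))
                (+-cong (ΣD-esym N (IsCommutingSquareZero-tail isCSZ) (suc k) f S) (ΣD′-D₀ S)) ⟩
    (D₀ (e′ (suc k)) S + 0#) + (ι (suc (suc k)) * e′ (suc (suc k)) S + ι (suc k) * D₀ (e′ (suc k)) S)
      ≈⟨ +-congʳ (+-identityʳ _) ⟩
    D₀ (e′ (suc k)) S + ((1# + ι (suc k)) * e′ (suc (suc k)) S + ι (suc k) * D₀ (e′ (suc k)) S)
      ≈⟨ a+[[1+c]*b+c*a]≈[1+c]*[b+a] _ _ _ ⟩
    ι (suc (suc k)) * (e′ (suc (suc k)) S + D₀ (e′ (suc k)) S)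
      ∎
    where
    open SetoidReasoning setoid
    open IsCommutingSquareZero isCSZ
    D₀ : Op _
    D₀ = D zero
    D′ : Fin N → Op _
    D′ = D ∘ suc
    e′ : ℕ → Ext _
    e′ = λ k → esym N D′ k f
    X : Ext _
    X = e′ (suc k) +E D₀ (e′ k)
    ΣD′-D₀ : ΣD N D′ (D₀ (e′ k)) ≈E ι (suc k) ·E D₀ (e′ (suc k))
    ΣD′-D₀ = ≈E.trans (ΣE-cong N (λ i → commute (suc i) zero _))
             (≈E.trans (≈E.sym (ΣE-homo (linear zero) N _))
             (≈E.trans (IsLinear.cong (linear zero) (ΣD-esym N (IsCommutingSquareZero-tail isCSZ) k f))
                       (IsLinear.·-homo (linear zero) _ _)))

  module _ (char0Field : IsChar0Field R) where
    open IsChar0Field char0Field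

    *-cancelˡ-≈0 : ∀ {a x} → ¬ (a ≈ 0#) → a * x ≈ 0# → x ≈ 0#
    *-cancelˡ-≈0 {a} {x} a≉0 ax≈0 with inverse a a≉0
    ... | a⁻¹ , aa⁻¹≈1 = begin
      x               ≈⟨ *-identityˡ x ⟨
      1# * x          ≈⟨ *-congʳ (≈-trans (*-comm a⁻¹ a) aa⁻¹≈1) ⟨
      (a⁻¹ * a) * x   ≈⟨ *-assoc _ _ _ ⟩
      a⁻¹ * (a * x)   ≈⟨ *-congˡ ax≈0 ⟩
      a⁻¹ * 0#        ≈⟨ zeroʳ _ ⟩
      0#              ∎
      where open SetoidReasoning setoid

    ·E-cancel : ∀ {m} a {v : Ext m} → ¬ (a ≈ 0#) → a ·E v ≈E 0E → v ≈E 0E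
    ·E-cancel a a≉0 av≈0 S = *-cancelˡ-≈0 a≉0 (av≈0 S)

    *-≉0 : ∀ {a b} → ¬ (a ≈ 0#) → ¬ (b ≈ 0#) → ¬ (a * b ≈ 0#)
    *-≉0 a≉0 b≉0 ab≈0 = b≉0 (*-cancelˡ-≈0 a≉0 ab≈0)

    -- Applying L shifts the relation one step along the chain, so by induction on M the
    -- tail of the chain vanishes, leaving w 0 · u 0 = 0.
    chain-relation⇒head-vanishes : ∀ {m} M {L : Op m} → IsLinear L →
      (u : ℕ → Ext m) (c : ℕ → K) → (∀ k → ¬ (c k ≈ 0#)) → (∀ k → L (u k) ≈E c k ·E u (suc k)) →
      (∀ k → M ≤ k → u k ≈E 0E) →
      (w : ℕ → K) → ¬ (w 0 ≈ 0#) →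
      ∀ len → ΣE (suc len) (λ k → w (Fin.toℕ k) ·E u (Fin.toℕ k)) ≈E 0E → u 0 ≈E 0E
    chain-relation⇒head-vanishes zero    lin u c c≉0 shift eventually w w₀≉0 len relation =
      eventually 0 z≤n
    chain-relation⇒head-vanishes (suc M) {L} lin u c c≉0 shift eventually w w₀≉0 len relation =
      ·E-cancel (w 0) w₀≉0 head-term
      where
      open ≈E-Reasoning
      L-term : ∀ k → L (w k ·E u k) ≈E (w k * c k) ·E u (suc k)
      L-term k = ≈E.trans (IsLinear.·-homo lin _ _)
                          (≈E.trans (·E-cong (w k) (shift k)) (λ S → ≈-sym (*-assoc _ _ _)))
      shifted-relation : ΣE (suc len) (λ k → (w (Fin.toℕ k) * c (Fin.toℕ k)) ·E u (suc (Fin.toℕ k))) ≈E 0E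
      shifted-relation = begin
        ΣE (suc len) (λ k → (w (Fin.toℕ k) * c (Fin.toℕ k)) ·E u (suc (Fin.toℕ k)))
          ≈⟨ ΣE-cong (suc len) (λ k → L-term (Fin.toℕ k)) ⟨
        ΣE (suc len) (λ k → L (w (Fin.toℕ k) ·E u (Fin.toℕ k)))
          ≈⟨ ΣE-homo lin (suc len) (λ k → w (Fin.toℕ k) ·E u (Fin.toℕ k)) ⟨
        L (ΣE (suc len) (λ k → w (Fin.toℕ k) ·E u (Fin.toℕ k)))
          ≈⟨ IsLinear.cong lin relation ⟩
        L 0E
          ≈⟨ IsLinear.0-homo lin ⟩
        0E
          ∎
      tail-vanishes : ∀ k → u (suc k) ≈E 0E
      tail-vanishes zero    =
        chain-relation⇒head-vanishes M lin (u ∘ suc) (c ∘ suc) (c≉0 ∘ suc) (shift ∘ suc)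
          (λ k M≤k → eventually (suc k) (s≤s M≤k)) (λ k → w k * c k) (*-≉0 w₀≉0 (c≉0 0)) len shifted-relation
      tail-vanishes (suc k) = ·E-cancel (c (suc k)) (c≉0 (suc k))
        (≈E.trans (≈E.sym (shift (suc k))) (≈E.trans (IsLinear.cong lin (tail-vanishes k)) (IsLinear.0-homo lin)))
      head-term : w 0 ·E u 0 ≈E 0E
      head-term S = ≈-trans
        (≈-sym (≈-trans (+-congˡ (ΣE-0 len {h = λ k → w (suc (Fin.toℕ k)) ·E u (suc (Fin.toℕ k))}
                                        (λ k S′ → ≈-trans (*-congˡ (tail-vanishes _ S′)) (zeroʳ _)) S))
                        (+-identityʳ _)))
        (relation S)

    esym-suc-vanishes : ∀ {m} N {D : Fin N → Op m} → IsCommutingSquareZero D →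
                        ∀ f → ΣD N D f ≈E 0E → ∀ k → esym N D (suc k) f ≈E 0E
    esym-suc-vanishes N isCSZ f τf≈0 zero    =
      ·E-cancel (ι 1) (char0 0) (≈E.trans (≈E.sym (ΣD-esym N isCSZ 0 f)) τf≈0)
    esym-suc-vanishes N {D} isCSZ f τf≈0 (suc k) =
      ·E-cancel (ι (suc (suc k))) (char0 (suc k))
        (≈E.trans (≈E.sym (ΣD-esym N isCSZ (suc k) f))
                  (≈E.trans (IsLinear.cong (ΣD-linear N D linear) (esym-suc-vanishes N isCSZ f τf≈0 k))
                            (IsLinear.0-homo (ΣD-linear N D linear))))
      where open IsCommutingSquareZero isCSZ

    ∏id+-fixed⇒ΣD-zero : ∀ {m} N {D : Fin N → Op m} → IsCommutingSquareZero D →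
                         ∀ f → ∏id+ N D f ≈E f → ΣD N D f ≈E 0E
    ∏id+-fixed⇒ΣD-zero zero          isCSZ f fixed = ≈E.refl
    ∏id+-fixed⇒ΣD-zero (suc l) {D} isCSZ f fixed =
      ≈E.trans (ΣD-esym (suc l) isCSZ 0 f) (λ S → ≈-trans (*-congˡ (e₁≈0 S)) (zeroʳ _))
      where
      open IsCommutingSquareZero isCSZ
      u : ℕ → Ext _
      u k = esym (suc l) D (suc k) f
      higher≈0 : ΣE (suc l) (λ k → 1# ·E u (Fin.toℕ k)) ≈E 0E
      higher≈0 S = +-identityʳ-unique (f S) _ (≈-trans
        (+-congˡ (ΣE-cong (suc l) {h = λ k → 1# ·E u (Fin.toℕ k)} (λ k S′ → *-identityˡ _) S))
        (≈-trans (≈-sym (∏id+≈Σesym (suc l) D linear f (suc (suc l)) ℕ.≤-refl S)) (fixed S)))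
      e₁≈0 : u 0 ≈E 0E
      e₁≈0 = chain-relation⇒head-vanishes (suc l) (ΣD-linear (suc l) D linear) u (λ k → ι (suc (suc k)))
               (λ k → char0 (suc k)) (λ k → ΣD-esym (suc l) isCSZ (suc k) f)
               (λ k l<k → esym-vanishes (suc l) D linear (suc k) f (s≤s l<k))
               (λ _ → 1#) 1≉0 l higher≈0

    ΣD-zero⇒∏id+-fixed : ∀ {m} N {D : Fin N → Op m} → IsCommutingSquareZero D →
                         ∀ f → ΣD N D f ≈E 0E → ∏id+ N D f ≈E f
    ΣD-zero⇒∏id+-fixed N {D} isCSZ f τf≈0 = begin
      ∏id+ N D f                                               ≈⟨ ∏id+≈Σesym N D linear f (suc N) ℕ.≤-refl ⟩
      f +E ΣE N (λ k → esym N D (suc (Fin.toℕ k)) f)            ≈⟨ +E-cong ≈E.refl higher≈0 ⟩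
      f +E 0E                                                  ≈⟨ (λ S → +-identityʳ _) ⟩
      f                                                        ∎
      where
      open ≈E-Reasoning
      open IsCommutingSquareZero isCSZ
      higher≈0 : ΣE N (λ k → esym N D (suc (Fin.toℕ k)) f) ≈E 0E
      higher≈0 = ΣE-0 N (λ k → esym-suc-vanishes N isCSZ f τf≈0 (Fin.toℕ k))

    ∏id+-fixed⇔ΣD-zero : ∀ {m} N {D : Fin N → Op m} → IsCommutingSquareZero D →
                         ∀ f → (∏id+ N D f ≈E f) ⇔ (ΣD N D f ≈E 0E)
    ∏id+-fixed⇔ΣD-zero N isCSZ f = mk⇔ (∏id+-fixed⇒ΣD-zero N isCSZ f) (ΣD-zero⇒∏id+-fixed N isCSZ f)

  -- The operators αᵢ ∂/∂θᵢ on Eₙ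

  module Eₙ (n : ℕ) where

    α↑ θ↑ : Fin n → Fin (n ℕ.+ n)
    α↑ i = i ↑ˡ n
    θ↑ i = n ↑ʳ i

    D : Fin n → Op (n ℕ.+ n)
    D i f = α i *E ∂ (θ↑ i) f

    D≈gen∧∂ : ∀ i f → D i f ≈E gen∧ (α↑ i) (∂ (θ↑ i) f)
    D≈gen∧∂ i f = gen-*E≈gen∧ (α↑ i) (∂ (θ↑ i) f)

    D-linear : ∀ i → IsLinear (D i)
    D-linear i = IsLinear-resp (D≈gen∧∂ i) (∘-linear (gen∧-linear (α↑ i)) (∂-linear (θ↑ i)))

    D-gen∧-comm : ∀ i v y → v ≢ θ↑ i → D i (gen∧ v y) ≈E gen∧ v (D i y)
    D-gen∧-comm i v y v≢θᵢ = ≈E.trans anticommuted (by-cases (v Fin.≟ α↑ i))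
      where
      w : E n
      w = ∂ (θ↑ i) y
      anticommuted : D i (gen∧ v y) ≈E -E gen∧ (α↑ i) (gen∧ v w)
      anticommuted = ≈E.trans (D≈gen∧∂ i (gen∧ v y))
        (≈E.trans (IsLinear.cong (gen∧-linear (α↑ i)) (∂-gen∧-anticomm (θ↑ i) v y v≢θᵢ))
                  (IsLinear.neg-homo (gen∧-linear (α↑ i)) (gen∧ v w)))
      by-cases : Dec (v ≡ α↑ i) → -E gen∧ (α↑ i) (gen∧ v w) ≈E gen∧ v (D i y)
      by-cases (yes refl) = ≈E.trans (-E-cong (gen∧-gen∧-same v w)) (≈E.trans -E0E≈0E
        (≈E.sym (≈E.trans (IsLinear.cong (gen∧-linear v) (D≈gen∧∂ i y)) (gen∧-gen∧-same v w))))
      by-cases (no v≢αᵢ) = ≈E.trans (-E-cong (gen∧-anticomm (α↑ i) v w (v≢αᵢ ∘ ≡.sym)))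
        (≈E.trans (-E-involutive _) (IsLinear.cong (gen∧-linear v) (≈E.sym (D≈gen∧∂ i y))))

    id+D-gen∧-comm : ∀ i v y → v ≢ θ↑ i → id+ (D i) (gen∧ v y) ≈E gen∧ v (id+ (D i) y)
    id+D-gen∧-comm i v y v≢θᵢ =
      ≈E.trans (+E-cong ≈E.refl (D-gen∧-comm i v y v≢θᵢ)) (≈E.sym (IsLinear.+-homo (gen∧-linear v) y (D i y)))

    D-D≈ : ∀ i j f → D i (D j f) ≈E -E gen∧ (α↑ i) (gen∧ (α↑ j) (∂ (θ↑ i) (∂ (θ↑ j) f)))
    D-D≈ i j f = ≈E.trans (D≈gen∧∂ i (D j f))
      (≈E.trans (IsLinear.cong (gen∧-linear (α↑ i)) (IsLinear.cong (∂-linear (θ↑ i)) (D≈gen∧∂ j f)))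
      (≈E.trans (IsLinear.cong (gen∧-linear (α↑ i)) (∂-gen∧-anticomm (θ↑ i) (α↑ j) (∂ (θ↑ j) f) (↑ˡ≢↑ʳ j i)))
                (IsLinear.neg-homo (gen∧-linear (α↑ i)) (gen∧ (α↑ j) (∂ (θ↑ i) (∂ (θ↑ j) f))))))

    D-isCommutingSquareZero : IsCommutingSquareZero D
    D-isCommutingSquareZero = record { linear = D-linear ; commute = commute ; square-zero = square-zero }
      where
      square-zero : ∀ i f → D i (D i f) ≈E 0E
      square-zero i f = ≈E.trans (D-D≈ i i f) (≈E.trans (-E-cong (gen∧-gen∧-same (α↑ i) (∂ (θ↑ i) (∂ (θ↑ i) f)))) -E0E≈0E)
      -- Two sign changes, from swapping the ∂'s and from swapping the α's, cancel.
      commute : ∀ i j f → D i (D j f) ≈E D j (D i f)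
      commute i j f with i Fin.≟ j
      ... | yes refl = ≈E.refl
      ... | no  i≢j  = ≈E.trans (D-D≈ i j f) (≈E.trans (-E-cong (≈E.sym swapped)) (≈E.sym (D-D≈ j i f)))
        where
        gen∧α : ∀ k → IsLinear (gen∧ (α↑ k))
        gen∧α k = gen∧-linear (α↑ k)
        w : E n
        w = ∂ (θ↑ i) (∂ (θ↑ j) f)
        swapped : gen∧ (α↑ j) (gen∧ (α↑ i) (∂ (θ↑ j) (∂ (θ↑ i) f))) ≈E gen∧ (α↑ i) (gen∧ (α↑ j) w)
        swapped =
          ≈E.trans (IsLinear.cong (gen∧α j) (IsLinear.cong (gen∧α i)
                     (∂-anticomm (θ↑ j) (θ↑ i) f (i≢j ∘ ≡.sym ∘ Fin.↑ʳ-injective n j i))))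
          (≈E.trans (IsLinear.cong (gen∧α j) (IsLinear.neg-homo (gen∧α i) w))
          (≈E.trans (IsLinear.neg-homo (gen∧α j) (gen∧ (α↑ i) w))
          (≈E.trans (-E-cong (gen∧-anticomm (α↑ j) (α↑ i) w (i≢j ∘ ≡.sym ∘ Fin.↑ˡ-injective n j i)))
                    (-E-involutive (gen∧ (α↑ i) (gen∧ (α↑ j) w))))))

    θα∧ : Fin n → Op (n ℕ.+ n)
    θα∧ i z = gen∧ (θ↑ i) z +E gen∧ (α↑ i) z

    D-θ∧ : ∀ i y → D i (gen∧ (θ↑ i) y) ≈E gen∧ (α↑ i) y +E gen∧ (θ↑ i) (D i y)
    D-θ∧ i y = begin
      D i (gen∧ t y)                      ≈⟨ D≈gen∧∂ i (gen∧ t y) ⟩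
      gen∧ a (∂ t (gen∧ t y))             ≈⟨ IsLinear.cong (gen∧-linear a) (∂-gen∧≈id-gen∧∂ t y) ⟩
      gen∧ a (y +E -E gen∧ t w)           ≈⟨ IsLinear.+-homo (gen∧-linear a) y (-E gen∧ t w) ⟩
      gen∧ a y +E gen∧ a (-E gen∧ t w)    ≈⟨ +E-cong ≈E.refl (IsLinear.neg-homo (gen∧-linear a) (gen∧ t w)) ⟩
      gen∧ a y +E -E gen∧ a (gen∧ t w)    ≈⟨ +E-cong ≈E.refl (-E-cong (gen∧-anticomm a t w (↑ˡ≢↑ʳ i i))) ⟩
      gen∧ a y +E -E -E gen∧ t (gen∧ a w) ≈⟨ +E-cong ≈E.refl (-E-involutive (gen∧ t (gen∧ a w))) ⟩
      gen∧ a y +E gen∧ t (gen∧ a w)       ≈⟨ +E-cong ≈E.refl (IsLinear.cong (gen∧-linear t) (D≈gen∧∂ i y)) ⟨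
      gen∧ a y +E gen∧ t (D i y)          ∎
      where
      open ≈E-Reasoning
      a t : Fin (n ℕ.+ n)
      a = α↑ i
      t = θ↑ i
      w : E n
      w = ∂ t y

    id+D-θ∧ : ∀ i y → id+ (D i) (gen∧ (θ↑ i) y) ≈E θα∧ i (id+ (D i) y)
    id+D-θ∧ i y S = begin
      p + D i (gen∧ (θ↑ i) y) S       ≈⟨ +-congˡ (D-θ∧ i y S) ⟩
      p + (r + q)                     ≈⟨ x∙yz≈xz∙y p r q ⟩
      (p + q) + r                     ≈⟨ +-congˡ (+-identityʳ r) ⟨
      (p + q) + (r + 0#)              ≈⟨ +-congˡ (+-congˡ αᵢ∧D≈0) ⟨
      (p + q) + (r + gen∧ (α↑ i) (D i y) S)
        ≈⟨ +-cong (IsLinear.+-homo (gen∧-linear (θ↑ i)) y (D i y) S)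
                  (IsLinear.+-homo (gen∧-linear (α↑ i)) y (D i y) S) ⟨
      θα∧ i (id+ (D i) y) S           ∎
      where
      open SetoidReasoning setoid
      open import Algebra.Properties.CommutativeSemigroup +-commutativeSemigroup using (x∙yz≈xz∙y)
      p q r : K
      p = gen∧ (θ↑ i) y S
      q = gen∧ (θ↑ i) (D i y) S
      r = gen∧ (α↑ i) y S
      αᵢ∧D≈0 : gen∧ (α↑ i) (D i y) S ≈ 0#
      αᵢ∧D≈0 = ≈-trans (IsLinear.cong (gen∧-linear (α↑ i)) (D≈gen∧∂ i y) S) (gen∧-gen∧-same (α↑ i) (∂ (θ↑ i) y) S)

    ∏id+-1E : ∏id+ n D 1E ≈E 1E
    ∏id+-1E = ∏id+-fixes-common-kernel n D D-linear 1E λ i →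
      ≈E.trans (D≈gen∧∂ i 1E) (≈E.trans (IsLinear.cong (gen∧-linear (α↑ i)) (∂-1E (θ↑ i)))
                                        (IsLinear.0-homo (gen∧-linear (α↑ i))))

    module _ (T : E n → E n) (isT : IsT n T) where

      T-linear : IsLinear T
      T-linear = record { cong = IsT.cong isT ; +-homo = IsT.hom-+ isT ; ·-homo = IsT.hom-· isT }

      ∏id+-α∧ : ∀ i y → ∏id+ n D (gen∧ (α↑ i) y) ≈E T (α i) *E ∏id+ n D y
      ∏id+-α∧ i y = begin
        ∏id+ n D (gen∧ (α↑ i) y)   ≈⟨ ∏id+-intertwines n D D-linear (gen∧ (α↑ i))
                                        (λ j z → id+D-gen∧-comm j (α↑ i) z (↑ˡ≢↑ʳ i j)) y ⟩
        gen∧ (α↑ i) (∏id+ n D y)   ≈⟨ gen-*E≈gen∧ (α↑ i) _ ⟨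
        α i *E ∏id+ n D y          ≈⟨ *E-cong (IsT.on-α isT i) ≈E.refl ⟨
        T (α i) *E ∏id+ n D y      ∎
        where open ≈E-Reasoning

      ∏id+-θ∧ : ∀ j y → ∏id+ n D (gen∧ (θ↑ j) y) ≈E T (θ j) *E ∏id+ n D y
      ∏id+-θ∧ j y = begin
        ∏id+ n D (gen∧ (θ↑ j) y)                   ≈⟨ ∏id+-intertwines-except n D D-linear j
                                                        (gen∧ (θ↑ j)) (θα∧ j) θⱼ-comm θα∧-comm (id+D-θ∧ j) y ⟩
        θα∧ j (∏id+ n D y)                         ≈⟨ +E-cong (gen-*E≈gen∧ (θ↑ j) _) (gen-*E≈gen∧ (α↑ j) _) ⟨
        (θ j *E ∏id+ n D y) +E (α j *E ∏id+ n D y) ≈⟨ *E-distribʳ (θ j) (α j) _ ⟨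
        (θ j +E α j) *E ∏id+ n D y                 ≈⟨ *E-cong (IsT.on-θ isT j) ≈E.refl ⟨
        T (θ j) *E ∏id+ n D y                      ∎
        where
        open ≈E-Reasoning
        θⱼ-comm : ∀ i → i ≢ j → ∀ z → id+ (D i) (gen∧ (θ↑ j) z) ≈E gen∧ (θ↑ j) (id+ (D i) z)
        θⱼ-comm i i≢j z = id+D-gen∧-comm i (θ↑ j) z (i≢j ∘ ≡.sym ∘ Fin.↑ʳ-injective n j i)
        θα∧-comm : ∀ i → i ≢ j → ∀ z → id+ (D i) (θα∧ j z) ≈E θα∧ j (id+ (D i) z)
        θα∧-comm i i≢j z = ≈E.trans (IsLinear.+-homo (id+-linear (D-linear i)) (gen∧ (θ↑ j) z) (gen∧ (α↑ j) z))
                             (+E-cong (θⱼ-comm i i≢j z) (id+D-gen∧-comm i (α↑ j) z (↑ˡ≢↑ʳ j i)))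

      ∏id+-gen∧ : ∀ v y → ∏id+ n D (gen∧ v y) ≈E T (gen v) *E ∏id+ n D y
      ∏id+-gen∧ v y with splitAt n v in v≡
      ... | inj₁ i = ≡.subst (λ v → ∏id+ n D (gen∧ v y) ≈E T (gen v) *E ∏id+ n D y)
                             (Fin.splitAt⁻¹-↑ˡ v≡) (∏id+-α∧ i y)
      ... | inj₂ j = ≡.subst (λ v → ∏id+ n D (gen∧ v y) ≈E T (gen v) *E ∏id+ n D y)
                             (Fin.splitAt⁻¹-↑ʳ v≡) (∏id+-θ∧ j y)

      T≈∏id+ : ∀ f → T f ≈E ∏id+ n D f
      T≈∏id+ = unital-hom-unique T-linear (∏id+-linear n D D-linear) (IsT.hom-* isT) (IsT.hom-1 isT)
                 ∏id+-1E ∏id+-gen∧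

      T-fixed⇔τ-zero : IsChar0Field R → ∀ f → (T f ≈E f) ⇔ (τ {n} f ≈E 0E)
      T-fixed⇔τ-zero char0Field f = mk⇔
        (λ Tf≈f → to (≈E.trans (≈E.sym (T≈∏id+ f)) Tf≈f))
        (λ τf≈0 → ≈E.trans (T≈∏id+ f) (from τf≈0))
        where open Equivalence (∏id+-fixed⇔ΣD-zero char0Field n D-isCommutingSquareZero f)

    bidegree-shift : ∀ S q → lookup S (α↑ q) ≡ true → lookup S (θ↑ q) ≡ false →
      let X = (S [ α↑ q ]≔ false) [ θ↑ q ]≔ true in
      suc ∣ take n X ∣ ≡ ∣ take n S ∣ × ∣ drop n X ∣ ≡ suc ∣ drop n S ∣
    bidegree-shift S q αq∈S θq∉S =
      ≡.trans (≡.cong (suc ∘ ∣_∣) (≡.trans (take-[]≔-↑ʳ n (S [ α↑ q ]≔ false) q true) (take-[]≔-↑ˡ n S q false)))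
              (∣p[i]≔outside∣ (take n S) q (≡.trans (lookup-take n S q) αq∈S)) ,
      ≡.trans (≡.cong ∣_∣ (≡.trans (drop-[]≔-↑ʳ n (S [ α↑ q ]≔ false) q true)
                                   (≡.cong (_[ q ]≔ true) (drop-[]≔-↑ˡ n S q false))))
              (∣p[i]≔inside∣ (drop n S) q (≡.trans (lookup-drop n S q) θq∉S))

    -- That is, τ has bidegree (1 , -1).
    τ-coefficient-local : ∀ S (g h : E n) →
      (∀ X → suc ∣ take n X ∣ ≡ ∣ take n S ∣ → ∣ drop n X ∣ ≡ suc ∣ drop n S ∣ → g X ≈ h X) →
      τ {n} g S ≈ τ {n} h S
    τ-coefficient-local S g h agree = ΣE-cong-at n S (λ q →
      ≈-trans (D≈gen∧∂ q g S) (≈-trans (term q) (≈-sym (D≈gen∧∂ q h S))))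
      where
      term : ∀ q → gen∧ (α↑ q) (∂ (θ↑ q) g) S ≈ gen∧ (α↑ q) (∂ (θ↑ q) h) S
      term q rewrite lookup∘update′ (↑ˡ≢↑ʳ q q ∘ ≡.sym) S false
        with lookup S (α↑ q) in αq∈S | lookup S (θ↑ q) in θq∈S
      ... | false | _     = ≈-refl
      ... | true  | true  = ≈-refl
      ... | true  | false with bidegree-shift S q αq∈S θq∈S
      ...   | αX , θX = *-congˡ (*-congˡ (agree _ αX θX))

    component-on : ∀ i j f X → ∣ take n X ∣ ≡ i → ∣ drop n X ∣ ≡ j → component {n} i j f X ≈ f X
    component-on i j f X ∣αX∣≡i ∣θX∣≡j with ∣ take n X ∣ ℕ.≟ i | ∣ drop n X ∣ ℕ.≟ j
    ... | yes _ | yes _ = ≈-refl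
    ... | no  ≢i | _    = ⊥-elim (≢i ∣αX∣≡i)
    ... | yes _ | no ≢j = ⊥-elim (≢j ∣θX∣≡j)

    component-off : ∀ i j f X → ¬ (∣ take n X ∣ ≡ i × ∣ drop n X ∣ ≡ j) → component {n} i j f X ≈ 0#
    component-off i j f X ≢ij with ∣ take n X ∣ ℕ.≟ i | ∣ drop n X ∣ ℕ.≟ j
    ... | yes ≡i | yes ≡j = ⊥-elim (≢ij (≡i , ≡j))
    ... | no  _  | _      = ≈-refl
    ... | yes _  | no _   = ≈-refl

    τ-0E : τ {n} 0E ≈E 0E
    τ-0E = IsLinear.0-homo (ΣD-linear n D D-linear)

    τ-zero⇒τ-component-zero : ∀ f → τ {n} f ≈E 0E → ∀ i j → τ {n} (component {n} i j f) ≈E 0E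
    τ-zero⇒τ-component-zero f τf≈0 i j S with ∣ take n S ∣ ℕ.≟ suc i | suc ∣ drop n S ∣ ℕ.≟ j
    ... | yes ∣αS∣≡1+i | yes 1+∣θS∣≡j =
      ≈-trans (τ-coefficient-local S (component {n} i j f) f λ X αX θX →
                 component-on i j f X (ℕ.suc-injective (≡.trans αX ∣αS∣≡1+i)) (≡.trans θX 1+∣θS∣≡j))
              (τf≈0 S)
    ... | no ∣αS∣≢1+i | _ =
      ≈-trans (τ-coefficient-local S (component {n} i j f) 0E λ X αX θX →
                 component-off i j f X λ (αX≡i , _) → ∣αS∣≢1+i (≡.trans (≡.sym αX) (≡.cong suc αX≡i)))
              (τ-0E S)
    ... | yes _ | no 1+∣θS∣≢j =
      ≈-trans (τ-coefficient-local S (component {n} i j f) 0E λ X αX θX →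
                 component-off i j f X λ (_ , θX≡j) → 1+∣θS∣≢j (≡.trans (≡.sym θX) θX≡j))
              (τ-0E S)

proposition3p2 : ∀ {c ℓ} (R : CommutativeRing c ℓ) → IsChar0Field R →
    let open Exterior R in
    (n : ℕ) → 1 ≤ n → (T : E n → E n) → IsT n T →
    ((f : E n) → (T f ≈E f) ⇔ (τ {n} f ≈E 0E)) ×
    ((f : E n) → T f ≈E f → (i j : ℕ) →
    T (component {n} i j f) ≈E component {n} i j f)
proposition3p2 R char0Field n _ T isT = fixed⇔τ-zero , components-fixed
  where
  open Exterior R
  open ExteriorAlgebra R
  open Eₙ n

  fixed⇔τ-zero : ∀ f → (T f ≈E f) ⇔ (τ {n} f ≈E 0E)
  fixed⇔τ-zero = T-fixed⇔τ-zero T isT char0Field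

  components-fixed : ∀ f → T f ≈E f → ∀ i j → T (component {n} i j f) ≈E component {n} i j f
  components-fixed f Tf≈f i j =
    Equivalence.from (fixed⇔τ-zero (component {n} i j f))
      (τ-zero⇒τ-component-zero f (Equivalence.to (fixed⇔τ-zero f) Tf≈f) i j)
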